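{- The exponential generating series of $112$-avoiding Cayley permutations is \[ \sum_{n\ge0} c_n\frac{x^n}{n!} = \frac12\left(1+\frac{1}{(1-x)^2}\right)=\frac{x^2-2x+2}{2(x-1)^2}, \] where $c_n$ is the number of Cayley permutations of length $n$ avoiding $112$.
   Context: A Cayley permutation of length $n$ is a word $w=w_1\cdots w_n$ of positive integers with $\{w_1,\dots,w_n\}=[k]$ for some $k\le n$; it avoids $112$ if there are no $i<j<k$ with $w_i=w_j<w_k$. -}

module Defs where

open import Data.Nat using (ℕ; zero; suc; _≤_; _<_; _!; z≤n; s≤s; _∸_)
open import Data.Nat.Properties using (_≤?_; _≟_; m≤n⇒m<n∨m≡n; m≤n⇒m≤1+n; ≤-refl; _!≢0)
open import Data.Fin using (Fin) renaming (_<_ to _<ᶠ_)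
open import Data.Fin.Properties using (all?; any?) renaming (_<?_ to _<ᶠ?_)
open import Data.Vec using (Vec; []; _∷_; lookup)
open import Data.List using (List; []; _∷_; map; concatMap; filter; length; upTo; foldr)
open import Data.Product using (_×_; _,_; ∃-syntax)
open import Data.Sum using (inj₁; inj₂)
open import Data.Empty using (⊥)
open import Relation.Nullary using (Dec; yes; no; ¬_)
open import Relation.Nullary.Decidable using (_×-dec_; _→-dec_; ¬?)
open import Relation.Binary.PropositionalEquality using (_≡_; refl)
open import Data.Integer using (ℤ; +_; -_)
open import Data.Rational using (ℚ; _/_; 0ℚ) renaming (_+_ to _+ℚ_; _*_ to _*ℚ_)

-- w is a Cayley permutation: all letters are positive integers, and the
-- set of letters is an initial segment [k] = {1,…,k}, i.e. whenever a
-- letter v occurs, every m with 1 ≤ m ≤ v occurs as well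
-- (then the letter set is exactly [max w]).
IsCayley : ∀ {n} → Vec ℕ n → Set
IsCayley {n} w =
  (∀ (i : Fin n) → 1 ≤ lookup w i) ×
  (∀ (i : Fin n) (m : ℕ) → 1 ≤ m → m ≤ lookup w i → ∃[ j ] lookup w j ≡ m)

Avoids112 : ∀ {n} → Vec ℕ n → Set
Avoids112 {n} w =
  ∀ (i j l : Fin n) → i <ᶠ j → j <ᶠ l →
    ¬ (lookup w i ≡ lookup w j × lookup w j < lookup w l)

allUpTo? : {P : ℕ → Set} → (∀ m → Dec (P m)) → ∀ k →
           Dec (∀ m → 1 ≤ m → m ≤ k → P m)
allUpTo? P? zero = yes (λ { m (s≤s _) () })
allUpTo? P? (suc k) with allUpTo? P? k | P? (suc k)
... | no ¬h | _ = no (λ h → ¬h (λ m a b → h m a (m≤n⇒m≤1+n b)))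
... | yes h | no ¬p = no (λ h' → ¬p (h' (suc k) (s≤s z≤n) (s≤s (≤-refl))))
... | yes h | yes p = yes f
  where f : ∀ m → 1 ≤ m → m ≤ suc k → _
        f m a b with m≤n⇒m<n∨m≡n b
        ... | inj₁ (s≤s q) = h m a q
        ... | inj₂ refl = p

isCayley? : ∀ {n} (w : Vec ℕ n) → Dec (IsCayley w)
isCayley? w =
  all? (λ i → 1 ≤? lookup w i) ×-dec
  all? (λ i → allUpTo? (λ m → any? (λ j → lookup w j ≟ m)) (lookup w i))

avoids112? : ∀ {n} (w : Vec ℕ n) → Dec (Avoids112 w)
avoids112? w =
  all? λ i → all? λ j → all? λ l →
    (i <ᶠ? j) →-dec ((j <ᶠ? l) →-dec
      ¬? ((lookup w i ≟ lookup w j) ×-dec (suc (lookup w j) ≤? lookup w l)))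

words : (len k : ℕ) → List (Vec ℕ len)
words zero k = [] ∷ []
words (suc len) k = concatMap (λ a → map (a ∷_) (words len k)) (map suc (upTo k))

-- c n = number of Cayley permutations of length n avoiding 112
-- (every Cayley permutation of length n has letters in {1,…,n}).
c : ℕ → ℕ
c n = length (filter (λ w → isCayley? w ×-dec avoids112? w) (words n n))

FPS : Set
FPS = ℕ → ℚ

_⊛_ : FPS → FPS → FPS
(f ⊛ g) n = foldr _+ℚ_ 0ℚ (map (λ k → f k *ℚ g (n ∸ k)) (upTo (suc n)))

poly : List ℚ → FPS
poly [] n = 0ℚ
poly (a ∷ as) zero = a
poly (a ∷ as) (suc n) = poly as n

egf : (ℕ → ℕ) → FPS
egf a n = (+ a n) / (n !) where instance _ = n !≢0

ι : ℤ → ℚ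
ι z = z / 1

-- A 112-avoiding Cayley permutation w of length n + 1 contains 1. If 1 occurs only once,
-- deleting it and lowering all other letters by one gives such a permutation of length n, and
-- conversely a 1 may be inserted at any of the n + 1 positions. If 1 occurs at least twice,
-- avoidance forces every letter after the second 1 to be 1, so w ends in 1, and removing that
-- last 1 gives such a permutation that still contains 1. Hence c₁ = 1 and
-- c (n + 1) = (n + 2) c n for n ≥ 1, that is c n / n! = (n + 1) / 2 for n ≥ 1. These
-- coefficients form an arithmetic progression from n = 1 on, so multiplying the series by
-- 2 (1 − x)², which takes second differences, leaves a polynomial of degree 2; its
-- coefficients are checked directly.

module Submission where

open import Defs
open import Data.Nat as ℕ using (ℕ; zero; suc; _≤_; _<_; z≤n; s≤s; _+_; _*_; _!)
import Data.Nat.Properties as ℕ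
open import Data.Fin as Fin using (Fin) renaming (_<_ to _<ᶠ_)
open import Data.Vec as Vec using (Vec; []; _∷_; lookup; insertAt; removeAt)
import Data.Vec.Properties as Vec
open import Data.Vec.Relation.Unary.All as All using (All; []; _∷_)
import Data.Vec.Relation.Unary.All.Properties as All
open import Data.Vec.Relation.Unary.Any as Any using (here; there)
import Data.Vec.Relation.Unary.Any.Properties as Any
open import Data.Vec.Membership.Propositional using () renaming (_∈_ to _∈ᵛ_; _∉_ to _∉ᵛ_)
open import Data.Vec.Membership.Propositional.Properties using (∈-lookup) renaming (∈-map⁺ to ∈ᵛ-map⁺)
open import Data.Vec.Membership.DecPropositional ℕ._≟_ using () renaming (_∈?_ to _∈ᵛ?_)
open import Data.List as List using (List; []; _∷_; [_]; _++_; concatMap; length; allFin; filter; upTo)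
import Data.List.Properties as List
open import Data.List.Relation.Unary.All as ListAll using ([])
open import Data.List.Relation.Unary.AllPairs using ([]; _∷_)
open import Data.List.Relation.Unary.Any using (here; there)
open import Data.List.Membership.Propositional using (_∈_; find; lose)
open import Data.List.Membership.Propositional.Properties
  using (∈-map⁺; ∈-map⁻; ∈-++⁺ˡ; ∈-++⁺ʳ; ∈-++⁻; ∈-concatMap⁺; ∈-concatMap⁻; ∈-allFin; ∈-upTo⁺;
         ∈-filter⁺; ∈-filter⁻)
open import Data.List.Relation.Unary.Unique.Propositional using (Unique)
import Data.List.Relation.Unary.Unique.Propositional.Properties as Unique
open import Data.List.Membership.Propositional.Properties.WithK using (unique∧set⇒bag)
open import Data.List.Relation.Binary.BagAndSetEquality using (_∼[_]_; set; ∼bag⇒↭)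
open import Data.List.Relation.Binary.Permutation.Propositional.Properties using (↭-length)
open import Data.Integer as ℤ using (ℤ; +_; -_)
open import Data.Integer.Tactic.RingSolver using (solve-∀)
import Data.Integer.Properties as ℤ
open import Data.Rational as ℚ using (ℚ; _/_; ½; 0ℚ) renaming (_+_ to _+ℚ_; _*_ to _*ℚ_)
import Data.Rational.Properties as ℚ
open import Data.Rational.Unnormalised as ℚᵘ using (mkℚᵘ; *≡*)
import Data.Rational.Unnormalised.Properties as ℚᵘ
open import Data.Rational.Solver using (module +-*-Solver)
open import Data.Product using (_×_; _,_; proj₁; proj₂; ∃)
open import Data.Sum using (_⊎_; inj₁; inj₂)
open import Data.Unit using (⊤; tt)
open import Relation.Nullary using (¬_; yes; no; contradiction)
open import Relation.Nullary.Decidable using (_×-dec_)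
open import Relation.Binary.PropositionalEquality hiding ([_])
open import Function using (_∘′_; mk⇔)

private
  variable
    A B : Set
    n : ℕ

∈-insertAt⁻ : ∀ {v y} (xs : Vec A n) i → v ∈ᵛ insertAt xs i y → v ≡ y ⊎ v ∈ᵛ xs
∈-insertAt⁻ xs       Fin.zero    (here v≡y) = inj₁ v≡y
∈-insertAt⁻ xs       Fin.zero    (there p)  = inj₂ p
∈-insertAt⁻ (x ∷ xs) (Fin.suc i) (here v≡x) = inj₂ (here v≡x)
∈-insertAt⁻ (x ∷ xs) (Fin.suc i) (there p)  with ∈-insertAt⁻ xs i p
... | inj₁ v≡y = inj₁ v≡y
... | inj₂ v∈xs = inj₂ (there v∈xs)

∈-insertAt⁺ˡ : ∀ {y} (xs : Vec A n) i → y ∈ᵛ insertAt xs i y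
∈-insertAt⁺ˡ xs       Fin.zero    = here refl
∈-insertAt⁺ˡ (x ∷ xs) (Fin.suc i) = there (∈-insertAt⁺ˡ xs i)

∈-insertAt⁺ʳ : ∀ {v y} {xs : Vec A n} i → v ∈ᵛ xs → v ∈ᵛ insertAt xs i y
∈-insertAt⁺ʳ Fin.zero    p         = there p
∈-insertAt⁺ʳ (Fin.suc i) (here p)  = here p
∈-insertAt⁺ʳ (Fin.suc i) (there p) = there (∈-insertAt⁺ʳ i p)

All-insertAt⁺ : ∀ {P : A → Set} {y} {xs : Vec A n} i → P y → All P xs → All P (insertAt xs i y)
All-insertAt⁺ Fin.zero    py ps         = py ∷ ps
All-insertAt⁺ (Fin.suc i) py (p ∷ ps) = p ∷ All-insertAt⁺ i py ps

All-insertAt⁻ : ∀ {P : A → Set} {y} (xs : Vec A n) i → All P (insertAt xs i y) → P y × All P xs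
All-insertAt⁻ xs       Fin.zero    (py ∷ ps) = py , ps
All-insertAt⁻ (x ∷ xs) (Fin.suc i) (p ∷ ps) with All-insertAt⁻ xs i ps
... | py , ps′ = py , p ∷ ps′

insertAt-injectiveˡ : ∀ {y} (xs ys : Vec A n) i → insertAt xs i y ≡ insertAt ys i y → xs ≡ ys
insertAt-injectiveˡ {y = y} xs ys i eq =
  trans (sym (Vec.removeAt-insertAt xs i y))
        (trans (cong (λ w → removeAt w i) eq) (Vec.removeAt-insertAt ys i y))

insertAt-injective : ∀ {y} (xs ys : Vec A n) i j → y ∉ᵛ xs → y ∉ᵛ ys →
                     insertAt xs i y ≡ insertAt ys j y → i ≡ j × xs ≡ ys
insertAt-injective xs       ys       Fin.zero    Fin.zero    _ _ eq = refl , Vec.∷-injectiveʳ eq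
insertAt-injective xs       (y ∷ ys) Fin.zero    (Fin.suc j) _ y∉ eq =
  contradiction (here (Vec.∷-injectiveˡ eq)) y∉
insertAt-injective (x ∷ xs) ys       (Fin.suc i) Fin.zero    y∉ _ eq =
  contradiction (here (sym (Vec.∷-injectiveˡ eq))) y∉
insertAt-injective (x ∷ xs) (y ∷ ys) (Fin.suc i) (Fin.suc j) y∉xs y∉ys eq
  with refl ← Vec.∷-injectiveˡ eq
  with refl , refl ← insertAt-injective xs ys i j (y∉xs ∘′ there) (y∉ys ∘′ there) (Vec.∷-injectiveʳ eq)
  = refl , refl

insertAt≡append⇒∈ : ∀ {y} (xs v : Vec A n) i → insertAt xs i y ≡ insertAt v (Fin.fromℕ n) y →
                    y ∈ᵛ v → y ∈ᵛ xs
insertAt≡append⇒∈ xs       (v₀ ∷ v) Fin.zero    eq _ =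
  subst (_ ∈ᵛ_) (sym (Vec.∷-injectiveʳ eq)) (∈-insertAt⁺ˡ v (Fin.fromℕ _))
insertAt≡append⇒∈ (x ∷ xs) (v₀ ∷ v) (Fin.suc i) eq (here y≡v₀) =
  here (trans y≡v₀ (sym (Vec.∷-injectiveˡ eq)))
insertAt≡append⇒∈ (x ∷ xs) (v₀ ∷ v) (Fin.suc i) eq (there y∈v) =
  there (insertAt≡append⇒∈ xs v i (Vec.∷-injectiveʳ eq) y∈v)

Unique-concatMap : (f : A → List B) {xs : List A} → Unique xs →
                   (∀ {x} → x ∈ xs → Unique (f x)) →
                   (∀ {x y z} → x ∈ xs → y ∈ xs → z ∈ f x → z ∈ f y → x ≡ y) →
                   Unique (concatMap f xs)
Unique-concatMap f {[]}     _                 _       _       = []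
Unique-concatMap f {x ∷ xs} (x∉xs ∷ uniqueₓₛ) uniqueᶠ shared⇒≡ =
  Unique.++⁺ (uniqueᶠ (here refl))
             (Unique-concatMap f uniqueₓₛ (uniqueᶠ ∘′ there) (λ x∈ y∈ → shared⇒≡ (there x∈) (there y∈)))
             λ (z∈fx , z∈rest) → let y , y∈xs , z∈fy = find (∈-concatMap⁻ f z∈rest) in
               ListAll.lookup x∉xs y∈xs (shared⇒≡ (here refl) (there y∈xs) z∈fx z∈fy)

Unique⇒length-≡ : {xs ys : List A} → Unique xs → Unique ys → xs ∼[ set ] ys → length xs ≡ length ys
Unique⇒length-≡ uniqueₓₛ uniqueᵧₛ xs≈ys = ↭-length (∼bag⇒↭ (unique∧set⇒bag uniqueₓₛ uniqueᵧₛ xs≈ys))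

length-concatMap-const : (f : A → List B) (xs : List A) {m : ℕ} → (∀ x → length (f x) ≡ m) →
                         length (concatMap f xs) ≡ length xs * m
length-concatMap-const f []       _    = refl
length-concatMap-const f (x ∷ xs) lenᶠ =
  trans (List.length-++ (f x)) (cong₂ _+_ (lenᶠ x) (length-concatMap-const f xs lenᶠ))

Positive : Vec ℕ n → Set
Positive = All (1 ≤_)

DownClosed : Vec ℕ n → Set
DownClosed w = ∀ {v} → v ∈ᵛ w → ∀ m → 1 ≤ m → m ≤ v → m ∈ᵛ w

Cayley : Vec ℕ n → Set
Cayley w = Positive w × DownClosed w

IsCayley⇒Cayley : (w : Vec ℕ n) → IsCayley w → Cayley w
IsCayley⇒Cayley w (pos , down) = All.lookup⁻ pos , down′
  where
  down′ : DownClosed w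
  down′ v∈w m 1≤m m≤v with j , refl ← down (Any.index v∈w) m 1≤m (subst (m ≤_) (Any.lookup-index v∈w) m≤v)
    = ∈-lookup j w

Cayley⇒IsCayley : (w : Vec ℕ n) → Cayley w → IsCayley w
Cayley⇒IsCayley w (pos , down) = All.lookup⁺ pos , λ i m 1≤m m≤wᵢ →
  let m∈w = down (∈-lookup i w) m 1≤m m≤wᵢ in Any.index m∈w , sym (Any.lookup-index m∈w)

one∈Cayley : (w : Vec ℕ (suc n)) → Cayley w → 1 ∈ᵛ w
one∈Cayley (x ∷ w) (1≤x ∷ _ , down) = down (here refl) 1 ℕ.≤-refl 1≤x

NoRiseFrom : ℕ → Vec ℕ n → Set
NoRiseFrom a []      = ⊤
NoRiseFrom a (x ∷ t) = (x ≡ a → All (_≤ a) t) × NoRiseFrom a t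

Avoids112′ : Vec ℕ n → Set
Avoids112′ []      = ⊤
Avoids112′ (a ∷ t) = NoRiseFrom a t × Avoids112′ t

Cayley112 : Vec ℕ n → Set
Cayley112 w = Cayley w × Avoids112′ w

NoRiseFrom⇒ : ∀ {a} (t : Vec ℕ n) → NoRiseFrom a t →
              ∀ j l → j <ᶠ l → lookup t j ≡ a → ¬ a < lookup t l
NoRiseFrom⇒ (x ∷ t) (x≡a⇒ , _) Fin.zero    (Fin.suc l) _         x≡a a<tₗ =
  ℕ.<⇒≱ a<tₗ (All.lookup⁺ (x≡a⇒ x≡a) l)
NoRiseFrom⇒ (x ∷ t) (_ , noRise) (Fin.suc j) (Fin.suc l) (s≤s j<l) = NoRiseFrom⇒ t noRise j l j<l

⇒NoRiseFrom : ∀ {a} (t : Vec ℕ n) → (∀ j l → j <ᶠ l → lookup t j ≡ a → ¬ a < lookup t l) →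
              NoRiseFrom a t
⇒NoRiseFrom []      _     = tt
⇒NoRiseFrom (x ∷ t) noAsc =
  (λ x≡a → All.lookup⁻ λ l → ℕ.≮⇒≥ (noAsc Fin.zero (Fin.suc l) (s≤s z≤n) x≡a)) ,
  ⇒NoRiseFrom t (λ j l j<l → noAsc (Fin.suc j) (Fin.suc l) (s≤s j<l))

Avoids112′⇒Avoids112 : (w : Vec ℕ n) → Avoids112′ w → Avoids112 w
Avoids112′⇒Avoids112 (a ∷ t) (noRise , _) Fin.zero (Fin.suc j) (Fin.suc l) _ (s≤s j<l) (a≡tⱼ , tⱼ<tₗ) =
  NoRiseFrom⇒ t noRise j l j<l (sym a≡tⱼ) (subst (_< lookup t l) (sym a≡tⱼ) tⱼ<tₗ)
Avoids112′⇒Avoids112 (a ∷ t) (_ , avoids) (Fin.suc i) (Fin.suc j) (Fin.suc l) (s≤s i<j) (s≤s j<l) =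
  Avoids112′⇒Avoids112 t avoids i j l i<j j<l

Avoids112⇒Avoids112′ : (w : Vec ℕ n) → Avoids112 w → Avoids112′ w
Avoids112⇒Avoids112′ []      _      = tt
Avoids112⇒Avoids112′ (a ∷ t) avoids =
  ⇒NoRiseFrom t (λ j l j<l tⱼ≡a a<tₗ →
    avoids Fin.zero (Fin.suc j) (Fin.suc l) (s≤s z≤n) (s≤s j<l) (sym tⱼ≡a , subst (_< lookup t l) (sym tⱼ≡a) a<tₗ)) ,
  Avoids112⇒Avoids112′ t (λ i j l i<j j<l → avoids (Fin.suc i) (Fin.suc j) (Fin.suc l) (s≤s i<j) (s≤s j<l))

insertMin : Vec ℕ n → Fin (suc n) → Vec ℕ (suc n)
insertMin u i = insertAt (Vec.map suc u) i 1

-- v ∷ʳ 1, written as an insertion so that the lemmas on insertAt apply.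
appendOne : Vec ℕ n → Vec ℕ (suc n)
appendOne {n} v = insertAt v (Fin.fromℕ n) 1

Positive-map-suc : (u : Vec ℕ n) → Positive (Vec.map suc u)
Positive-map-suc u = All.map⁺ (All.universal (λ _ → s≤s z≤n) u)

∈-map-suc⁻ : ∀ {m} {u : Vec ℕ n} → suc m ∈ᵛ Vec.map suc u → m ∈ᵛ u
∈-map-suc⁻ m∈ = Any.map ℕ.suc-injective (Any.map⁻ m∈)

1∉map-suc : {u : Vec ℕ n} → Positive u → 1 ∉ᵛ Vec.map suc u
1∉map-suc pos 1∈ with () ← All.lookup pos (∈-map-suc⁻ 1∈)

map-suc-injective : (u u′ : Vec ℕ n) → Vec.map suc u ≡ Vec.map suc u′ → u ≡ u′
map-suc-injective []      []        _  = refl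
map-suc-injective (x ∷ u) (x′ ∷ u′) eq =
  cong₂ _∷_ (ℕ.suc-injective (Vec.∷-injectiveˡ eq)) (map-suc-injective u u′ (Vec.∷-injectiveʳ eq))

insertMin-injective : (u u′ : Vec ℕ n) (i j : Fin (suc n)) → Positive u → Positive u′ →
                      insertMin u i ≡ insertMin u′ j → i ≡ j × u ≡ u′
insertMin-injective u u′ i j pos pos′ eq
  with refl , eq′ ← insertAt-injective (Vec.map suc u) (Vec.map suc u′) i j (1∉map-suc pos) (1∉map-suc pos′) eq
  = refl , map-suc-injective u u′ eq′

insertMin≢appendOne : (u v : Vec ℕ n) (i : Fin (suc n)) → Positive u → 1 ∈ᵛ v → insertMin u i ≢ appendOne v
insertMin≢appendOne u v i pos 1∈v eq = 1∉map-suc pos (insertAt≡append⇒∈ (Vec.map suc u) v i eq 1∈v)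

Cayley-insertMin⁺ : (u : Vec ℕ n) (i : Fin (suc n)) → Cayley u → Cayley (insertMin u i)
Cayley-insertMin⁺ u i (_ , down) = All-insertAt⁺ i ℕ.≤-refl (Positive-map-suc u) , down′
  where
  down′ : DownClosed (insertMin u i)
  down′ {v}     _  (suc zero)    _ _         = ∈-insertAt⁺ˡ (Vec.map suc u) i
  down′ {suc v} v∈ (suc (suc m)) _ (s≤s m<v) with ∈-insertAt⁻ (Vec.map suc u) i v∈
  ... | inj₁ refl with () ← m<v
  ... | inj₂ v∈u = ∈-insertAt⁺ʳ i (∈ᵛ-map⁺ suc (down (∈-map-suc⁻ v∈u) (suc m) (s≤s z≤n) m<v))

Cayley-insertMin⁻ : (u : Vec ℕ n) (i : Fin (suc n)) → Positive u → Cayley (insertMin u i) → Cayley u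
Cayley-insertMin⁻ u i pos (_ , down) = pos , down′
  where
  down′ : DownClosed u
  down′ v∈u m 1≤m m≤v
    with ∈-insertAt⁻ (Vec.map suc u) i (down (∈-insertAt⁺ʳ i (∈ᵛ-map⁺ suc v∈u)) (suc m) (s≤s z≤n) (s≤s m≤v))
  ... | inj₁ refl with () ← 1≤m
  ... | inj₂ m∈u = ∈-map-suc⁻ m∈u

Cayley-appendOne⁺ : (v : Vec ℕ n) → 1 ∈ᵛ v → Cayley v → Cayley (appendOne v)
Cayley-appendOne⁺ {n} v _ (pos , down) = All-insertAt⁺ (Fin.fromℕ n) ℕ.≤-refl pos , down′
  where
  down′ : DownClosed (appendOne v)
  down′ x∈ m 1≤m m≤x with ∈-insertAt⁻ v (Fin.fromℕ n) x∈
  ... | inj₁ refl with refl ← ℕ.≤-antisym m≤x 1≤m = ∈-insertAt⁺ˡ v (Fin.fromℕ n)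
  ... | inj₂ x∈v = ∈-insertAt⁺ʳ (Fin.fromℕ n) (down x∈v m 1≤m m≤x)

Cayley-appendOne⁻ : (v : Vec ℕ n) → 1 ∈ᵛ v → Cayley (appendOne v) → Cayley v
Cayley-appendOne⁻ {n} v 1∈v (pos , down) = proj₂ (All-insertAt⁻ v (Fin.fromℕ n) pos) , down′
  where
  down′ : DownClosed v
  down′ x∈v m 1≤m m≤x with ∈-insertAt⁻ v (Fin.fromℕ n) (down (∈-insertAt⁺ʳ (Fin.fromℕ n) x∈v) m 1≤m m≤x)
  ... | inj₁ refl = 1∈v
  ... | inj₂ m∈v = m∈v

NoRiseFrom-insertAt⁻ : ∀ {a y} (xs : Vec ℕ n) i → NoRiseFrom a (insertAt xs i y) → NoRiseFrom a xs
NoRiseFrom-insertAt⁻ xs       Fin.zero    (_ , noRise)    = noRise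
NoRiseFrom-insertAt⁻ (x ∷ xs) (Fin.suc i) (bound , noRise) =
  (λ x≡a → proj₂ (All-insertAt⁻ xs i (bound x≡a))) , NoRiseFrom-insertAt⁻ xs i noRise

Avoids112′-insertAt⁻ : ∀ {y} (xs : Vec ℕ n) i → Avoids112′ (insertAt xs i y) → Avoids112′ xs
Avoids112′-insertAt⁻ xs       Fin.zero    (_ , avoids)      = avoids
Avoids112′-insertAt⁻ (x ∷ xs) (Fin.suc i) (noRise , avoids) =
  NoRiseFrom-insertAt⁻ xs i noRise , Avoids112′-insertAt⁻ xs i avoids

NoRiseFrom-map-suc⁺ : ∀ {a} (u : Vec ℕ n) → NoRiseFrom a u → NoRiseFrom (suc a) (Vec.map suc u)
NoRiseFrom-map-suc⁺ []      _                = tt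
NoRiseFrom-map-suc⁺ (x ∷ u) (bound , noRise) =
  (λ x+1≡a+1 → All.map⁺ (All.map s≤s (bound (ℕ.suc-injective x+1≡a+1)))) , NoRiseFrom-map-suc⁺ u noRise

NoRiseFrom-map-suc⁻ : ∀ {a} (u : Vec ℕ n) → NoRiseFrom (suc a) (Vec.map suc u) → NoRiseFrom a u
NoRiseFrom-map-suc⁻ []      _                = tt
NoRiseFrom-map-suc⁻ (x ∷ u) (bound , noRise) =
  (λ x≡a → All.map ℕ.≤-pred (All.map⁻ (bound (cong suc x≡a)))) , NoRiseFrom-map-suc⁻ u noRise

Avoids112′-map-suc⁺ : (u : Vec ℕ n) → Avoids112′ u → Avoids112′ (Vec.map suc u)
Avoids112′-map-suc⁺ []      _                 = tt
Avoids112′-map-suc⁺ (x ∷ u) (noRise , avoids) = NoRiseFrom-map-suc⁺ u noRise , Avoids112′-map-suc⁺ u avoids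

Avoids112′-map-suc⁻ : (u : Vec ℕ n) → Avoids112′ (Vec.map suc u) → Avoids112′ u
Avoids112′-map-suc⁻ []      _                 = tt
Avoids112′-map-suc⁻ (x ∷ u) (noRise , avoids) = NoRiseFrom-map-suc⁻ u noRise , Avoids112′-map-suc⁻ u avoids

NoRiseFrom-insertAt-smaller : ∀ {a y} (xs : Vec ℕ n) i → y < a → NoRiseFrom a xs → NoRiseFrom a (insertAt xs i y)
NoRiseFrom-insertAt-smaller xs       Fin.zero    y<a noRise           = (λ y≡a → contradiction y≡a (ℕ.<⇒≢ y<a)) , noRise
NoRiseFrom-insertAt-smaller (x ∷ xs) (Fin.suc i) y<a (bound , noRise) =
  (λ x≡a → All-insertAt⁺ i (ℕ.<⇒≤ y<a) (bound x≡a)) , NoRiseFrom-insertAt-smaller xs i y<a noRise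

NoRiseFrom-absent : ∀ {a} (xs : Vec ℕ n) → a ∉ᵛ xs → NoRiseFrom a xs
NoRiseFrom-absent []       _   = tt
NoRiseFrom-absent (x ∷ xs) a∉ = (λ x≡a → contradiction (here (sym x≡a)) a∉) , NoRiseFrom-absent xs (a∉ ∘′ there)

Avoids112′-insertAt-min : ∀ {y} (xs : Vec ℕ n) i → All (y <_) xs → Avoids112′ xs → Avoids112′ (insertAt xs i y)
Avoids112′-insertAt-min xs Fin.zero below avoids =
  NoRiseFrom-absent xs (λ y∈xs → ℕ.<-irrefl refl (All.lookup below y∈xs)) , avoids
Avoids112′-insertAt-min (x ∷ xs) (Fin.suc i) (y<x ∷ below) (noRise , avoids) =
  NoRiseFrom-insertAt-smaller xs i y<x noRise , Avoids112′-insertAt-min xs i below avoids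

NoRiseFrom-appendOne : ∀ {a} (v : Vec ℕ n) → 1 ≤ a → NoRiseFrom a v → NoRiseFrom a (appendOne v)
NoRiseFrom-appendOne []      _   _                = (λ _ → []) , tt
NoRiseFrom-appendOne (x ∷ v) 1≤a (bound , noRise) =
  (λ x≡a → All-insertAt⁺ (Fin.fromℕ _) 1≤a (bound x≡a)) , NoRiseFrom-appendOne v 1≤a noRise

Avoids112′-appendOne : (v : Vec ℕ n) → Positive v → Avoids112′ v → Avoids112′ (appendOne v)
Avoids112′-appendOne []      _          _                 = tt , tt
Avoids112′-appendOne (x ∷ v) (1≤x ∷ pos) (noRise , avoids) =
  NoRiseFrom-appendOne v 1≤x noRise , Avoids112′-appendOne v pos avoids

Cayley112-insertMin⁺ : (u : Vec ℕ n) (i : Fin (suc n)) → Cayley112 u → Cayley112 (insertMin u i)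
Cayley112-insertMin⁺ u i (cayley@(pos , _) , avoids) =
  Cayley-insertMin⁺ u i cayley ,
  Avoids112′-insertAt-min (Vec.map suc u) i (All.map⁺ (All.map s≤s pos)) (Avoids112′-map-suc⁺ u avoids)

Cayley112-insertMin⁻ : (u : Vec ℕ n) (i : Fin (suc n)) → Positive u → Cayley112 (insertMin u i) → Cayley112 u
Cayley112-insertMin⁻ u i pos (cayley , avoids) =
  Cayley-insertMin⁻ u i pos cayley ,
  Avoids112′-map-suc⁻ u (Avoids112′-insertAt⁻ (Vec.map suc u) i avoids)

Cayley112-appendOne⁺ : (v : Vec ℕ n) → 1 ∈ᵛ v → Cayley112 v → Cayley112 (appendOne v)
Cayley112-appendOne⁺ v 1∈v (cayley@(pos , _) , avoids) =
  Cayley-appendOne⁺ v 1∈v cayley , Avoids112′-appendOne v pos avoids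

Cayley112-appendOne⁻ : (v : Vec ℕ n) → 1 ∈ᵛ v → Cayley112 (appendOne v) → Cayley112 v
Cayley112-appendOne⁻ {n} v 1∈v (cayley , avoids) =
  Cayley-appendOne⁻ v 1∈v cayley , Avoids112′-insertAt⁻ v (Fin.fromℕ n) avoids

data Decomposition : Vec ℕ (suc n) → Set where
  inserted : (u : Vec ℕ n) (i : Fin (suc n)) → Positive u → Decomposition (insertMin u i)
  appended : (v : Vec ℕ n) → 1 ∈ᵛ v → Decomposition (appendOne v)

positive-without-1⇒map-suc : (t : Vec ℕ n) → Positive t → 1 ∉ᵛ t → ∃ λ u → Positive u × t ≡ Vec.map suc u
positive-without-1⇒map-suc []                  []        _  = [] , [] , refl
positive-without-1⇒map-suc (zero        ∷ t) (() ∷ _)  _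
positive-without-1⇒map-suc (suc zero    ∷ t) _         1∉ = contradiction (here refl) 1∉
positive-without-1⇒map-suc (suc (suc x) ∷ t) (_ ∷ pos) 1∉
  with u , posᵤ , refl ← positive-without-1⇒map-suc t pos (1∉ ∘′ there)
  = suc x ∷ u , s≤s z≤n ∷ posᵤ , refl

constant⇒∷≡append : ∀ {a} (t : Vec ℕ n) → All (_≡ a) t → a ∷ t ≡ insertAt t (Fin.fromℕ n) a
constant⇒∷≡append []      []            = refl
constant⇒∷≡append (x ∷ t) (refl ∷ same) = cong (x ∷_) (constant⇒∷≡append t same)

NoRiseFrom⇒endsWith : ∀ {a} (t : Vec ℕ (suc n)) → NoRiseFrom a t → a ∈ᵛ t → All (a ≤_) t →
                      ∃ λ t′ → t ≡ insertAt t′ (Fin.fromℕ n) a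
NoRiseFrom⇒endsWith (y ∷ t) (bound , _) (here refl) (_ ∷ above) =
  t , constant⇒∷≡append t (All.map (λ (x≤a , a≤x) → ℕ.≤-antisym x≤a a≤x) (All.zip (bound refl , above)))
NoRiseFrom⇒endsWith {suc n} (y ∷ t) (_ , noRise) (there a∈t) (_ ∷ above)
  with t′ , refl ← NoRiseFrom⇒endsWith t noRise a∈t above
  = y ∷ t′ , refl

decompose : (w : Vec ℕ (suc n)) → Positive w → Avoids112′ w → 1 ∈ᵛ w → Decomposition w
decompose (suc zero ∷ t) (_ ∷ pos) (noRise , _) _ with 1 ∈ᵛ? t
... | no 1∉t with u , posᵤ , refl ← positive-without-1⇒map-suc t pos 1∉t = inserted u Fin.zero posᵤ
decompose {zero}  (suc zero ∷ []) _ _ _ | yes ()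
decompose {suc n} (suc zero ∷ t) (_ ∷ pos) (noRise , _) _ | yes 1∈t
  with t′ , refl ← NoRiseFrom⇒endsWith t noRise 1∈t pos = appended (1 ∷ t′) (here refl)
decompose {suc n} (suc (suc x) ∷ t) (_ ∷ pos) (_ , avoids) (there 1∈t) with decompose t pos avoids 1∈t
... | inserted u i posᵤ = inserted (suc x ∷ u) (Fin.suc i) (s≤s z≤n ∷ posᵤ)
... | appended v 1∈v   = appended (suc (suc x) ∷ v) (there 1∈v)

insertMinEverywhere : Vec ℕ n → List (Vec ℕ (suc n))
insertMinEverywhere u = List.map (insertMin u) (allFin _)

-- The case n = 1 is separate since appending to [] would list [1] twice.
cayley112s : (n : ℕ) → List (Vec ℕ n)
cayley112s zero          = [ [] ]
cayley112s (suc zero)    = [ 1 ∷ [] ]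
cayley112s (suc (suc n)) =
  concatMap insertMinEverywhere (cayley112s (suc n)) ++ List.map appendOne (cayley112s (suc n))

data Extension (ws : List (Vec ℕ n)) : Vec ℕ (suc n) → Set where
  viaInsertMin : ∀ {u} i → u ∈ ws → Extension ws (insertMin u i)
  viaAppendOne : ∀ {v} → v ∈ ws → Extension ws (appendOne v)

∈-cayley112s⁻ : ∀ {w} → w ∈ cayley112s (suc (suc n)) → Extension (cayley112s (suc n)) w
∈-cayley112s⁻ {n} w∈ with ∈-++⁻ (concatMap insertMinEverywhere (cayley112s (suc n))) w∈
... | inj₁ w∈ins
  with u , u∈ , w∈insᵤ ← find (∈-concatMap⁻ insertMinEverywhere w∈ins)
  with i , _ , refl ← ∈-map⁻ (insertMin u) {xs = allFin (suc (suc n))} w∈insᵤ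
  = viaInsertMin i u∈
... | inj₂ w∈app with v , v∈ , refl ← ∈-map⁻ appendOne w∈app = viaAppendOne v∈

insertMin-∈ : ∀ {u} i → u ∈ cayley112s (suc n) → insertMin u i ∈ cayley112s (suc (suc n))
insertMin-∈ {u = u} i u∈ = ∈-++⁺ˡ (∈-concatMap⁺ insertMinEverywhere (lose u∈ (∈-map⁺ (insertMin u) (∈-allFin i))))

appendOne-∈ : ∀ {v} → v ∈ cayley112s (suc n) → appendOne v ∈ cayley112s (suc (suc n))
appendOne-∈ {n} v∈ = ∈-++⁺ʳ (concatMap insertMinEverywhere (cayley112s (suc n))) (∈-map⁺ appendOne v∈)

cayley112s-ind : (P : ∀ {n} → Vec ℕ n → Set) → P [] → P (1 ∷ []) →
                 (∀ {n} {u : Vec ℕ (suc n)} i → P u → P (insertMin u i)) →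
                 (∀ {n} {v : Vec ℕ (suc n)} → P v → P (appendOne v)) →
                 ∀ n {w} → w ∈ cayley112s n → P w
cayley112s-ind P P[] P[1] P-insertMin P-appendOne = go
  where
  step : ∀ {n w} → (∀ {u} → u ∈ cayley112s (suc n) → P u) → Extension (cayley112s (suc n)) w → P w
  step ih (viaInsertMin i u∈) = P-insertMin i (ih u∈)
  step ih (viaAppendOne v∈)   = P-appendOne (ih v∈)

  go : ∀ n {w} → w ∈ cayley112s n → P w
  go zero          (here refl) = P[]
  go (suc zero)    (here refl) = P[1]
  go (suc (suc n)) w∈          = step (go (suc n)) (∈-cayley112s⁻ w∈)

cayley112s-sound : ∀ n {w} → w ∈ cayley112s n → Cayley112 w
cayley112s-sound = cayley112s-ind Cayley112 (([] , λ ()) , tt) (Cayley112-insertMin⁺ [] Fin.zero (([] , λ ()) , tt))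
  (λ i → Cayley112-insertMin⁺ _ i)
  (λ good → Cayley112-appendOne⁺ _ (one∈Cayley _ (proj₁ good)) good)

cayley112s-bounded : ∀ n {w} → w ∈ cayley112s n → All (_≤ n) w
cayley112s-bounded = cayley112s-ind (λ {n} w → All (_≤ n) w) [] (ℕ.≤-refl ∷ [])
  (λ i bound → All-insertAt⁺ i (s≤s z≤n) (All.map⁺ (All.map s≤s bound)))
  (λ bound → All-insertAt⁺ _ (s≤s z≤n) (All.map ℕ.m≤n⇒m≤1+n bound))

cayley112s-complete : (w : Vec ℕ n) → Cayley112 w → w ∈ cayley112s n
cayley112s-complete [] _ = here refl
cayley112s-complete (x ∷ []) (cayley , _) with here refl ← one∈Cayley (x ∷ []) cayley = here refl
cayley112s-complete {suc (suc n)} w good@((pos , _) , avoids) =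
  from (decompose w pos avoids (one∈Cayley w (proj₁ good))) good cayley112s-complete
  where
  from : ∀ {w} → Decomposition w → Cayley112 w →
         (∀ (u : Vec ℕ (suc n)) → Cayley112 u → u ∈ cayley112s (suc n)) → w ∈ cayley112s (suc (suc n))
  from (inserted u i posᵤ) good complete = insertMin-∈ i (complete u (Cayley112-insertMin⁻ u i posᵤ good))
  from (appended v 1∈v)    good complete = appendOne-∈ (complete v (Cayley112-appendOne⁻ v 1∈v good))

cayley112s-unique : ∀ n → Unique (cayley112s n)
cayley112s-unique zero          = [] ∷ []
cayley112s-unique (suc zero)    = [] ∷ []
cayley112s-unique (suc (suc n)) =
  Unique.++⁺ (Unique-concatMap insertMinEverywhere (cayley112s-unique (suc n)) insertions-unique same-insertion⇒≡)
             (Unique.map⁺ (insertAt-injectiveˡ _ _ (Fin.fromℕ (suc n))) (cayley112s-unique (suc n)))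
             insertion≢appending
  where
  positive : ∀ {u} → u ∈ cayley112s (suc n) → Positive u
  positive u∈ = proj₁ (proj₁ (cayley112s-sound (suc n) u∈))

  insertions-unique : ∀ {u} → u ∈ cayley112s (suc n) → Unique (insertMinEverywhere u)
  insertions-unique {u} u∈ =
    Unique.map⁺ (λ {i} {j} eq → proj₁ (insertMin-injective u u i j (positive u∈) (positive u∈) eq)) (Unique.allFin⁺ _)

  same-insertion⇒≡ : ∀ {u u′ w} → u ∈ cayley112s (suc n) → u′ ∈ cayley112s (suc n) →
                        w ∈ insertMinEverywhere u → w ∈ insertMinEverywhere u′ → u ≡ u′
  same-insertion⇒≡ {u} {u′} u∈ u′∈ w∈ w∈′
    with i , _ , refl ← ∈-map⁻ (insertMin u) {xs = allFin (suc (suc n))} w∈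
    with j , _ , eq ← ∈-map⁻ (insertMin u′) {xs = allFin (suc (suc n))} w∈′
    = proj₂ (insertMin-injective u u′ i j (positive u∈) (positive u′∈) eq)

  insertion≢appending : ∀ {w} → ¬ (w ∈ concatMap insertMinEverywhere (cayley112s (suc n)) ×
                                      w ∈ List.map appendOne (cayley112s (suc n)))
  insertion≢appending (w∈ins , w∈app)
    with u , u∈ , w∈insᵤ ← find (∈-concatMap⁻ insertMinEverywhere w∈ins)
    with i , _ , refl ← ∈-map⁻ (insertMin u) {xs = allFin (suc (suc n))} w∈insᵤ
    with v , v∈ , eq ← ∈-map⁻ appendOne w∈app
    = insertMin≢appendOne u v i (positive u∈) (one∈Cayley v (proj₁ (cayley112s-sound (suc n) v∈))) eq

length-cayley112s : ∀ n → length (cayley112s (suc (suc n))) ≡ (3 + n) * length (cayley112s (suc n))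
length-cayley112s n = begin
  length (concatMap insertMinEverywhere ws ++ List.map appendOne ws)
    ≡⟨ List.length-++ (concatMap insertMinEverywhere ws) ⟩
  length (concatMap insertMinEverywhere ws) + length (List.map appendOne ws)
    ≡⟨ cong₂ _+_ (length-concatMap-const insertMinEverywhere ws length-insertions) (List.length-map appendOne ws) ⟩
  length ws * (2 + n) + length ws
    ≡⟨ ℕ.+-comm (length ws * (2 + n)) (length ws) ⟩
  length ws + length ws * (2 + n)
    ≡⟨ cong (_+_ (length ws)) (ℕ.*-comm (length ws) (2 + n)) ⟩
  (3 + n) * length ws ∎
  where
  open ≡-Reasoning
  ws = cayley112s (suc n)
  length-insertions : ∀ u → length (insertMinEverywhere u) ≡ 2 + n
  length-insertions u = trans (List.length-map (insertMin u) (allFin _)) (List.length-tabulate (λ i → i))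

∈-words : (w : Vec ℕ n) (k : ℕ) → Positive w → All (_≤ k) w → w ∈ words n k
∈-words []          k []          []            = here refl
∈-words (suc x ∷ t) k (_ ∷ pos) (x<k ∷ bound) =
  ∈-concatMap⁺ (λ a → List.map (a ∷_) (words _ k))
    (lose (∈-map⁺ suc (∈-upTo⁺ x<k)) (∈-map⁺ (suc x ∷_) (∈-words t k pos bound)))

words-unique : ∀ n k → Unique (words n k)
words-unique zero    k = [] ∷ []
words-unique (suc n) k =
  Unique-concatMap (λ a → List.map (a ∷_) (words n k)) (Unique.map⁺ ℕ.suc-injective (Unique.upTo⁺ k))
    (λ _ → Unique.map⁺ Vec.∷-injectiveʳ (words-unique n k)) same-head
  where
  same-head : ∀ {a b w} → a ∈ _ → b ∈ _ → w ∈ List.map (a ∷_) (words n k) → w ∈ List.map (b ∷_) (words n k) → a ≡ b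
  same-head _ _ w∈ w∈′
    with _ , _ , refl ← ∈-map⁻ _ w∈
    with _ , _ , eq ← ∈-map⁻ _ w∈′
    = Vec.∷-injectiveˡ eq

c≡length-cayley112s : ∀ n → c n ≡ length (cayley112s n)
c≡length-cayley112s n =
  Unique⇒length-≡ (Unique.filter⁺ good? (words-unique n n)) (cayley112s-unique n) (mk⇔ to from)
  where
  good? = λ (w : Vec ℕ n) → isCayley? w ×-dec avoids112? w
  to : ∀ {w} → w ∈ filter good? (words n n) → w ∈ cayley112s n
  to {w} w∈ with _ , isCayley , avoids ← ∈-filter⁻ good? {xs = words n n} w∈ =
    cayley112s-complete w (IsCayley⇒Cayley w isCayley , Avoids112⇒Avoids112′ w avoids)
  from : ∀ {w} → w ∈ cayley112s n → w ∈ filter good? (words n n)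
  from {w} w∈ with (cayley@(pos , _) , avoids) ← cayley112s-sound n w∈ =
    ∈-filter⁺ good? (∈-words w n pos (cayley112s-bounded n w∈)) (Cayley⇒IsCayley w cayley , Avoids112′⇒Avoids112 w avoids)

c-suc-suc : ∀ n → c (suc (suc n)) ≡ (3 + n) * c (suc n)
c-suc-suc n = begin
  c (2 + n)                             ≡⟨ c≡length-cayley112s (2 + n) ⟩
  length (cayley112s (2 + n))           ≡⟨ length-cayley112s n ⟩
  (3 + n) * length (cayley112s (1 + n)) ≡⟨ cong ((3 + n) *_) (c≡length-cayley112s (1 + n)) ⟨
  (3 + n) * c (1 + n)                   ∎
  where open ≡-Reasoning

c-suc*2≡! : ∀ n → c (suc n) * 2 ≡ (2 + n) !
c-suc*2≡! zero    = refl
c-suc*2≡! (suc n) = begin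
  c (2 + n) * 2             ≡⟨ cong (_* 2) (c-suc-suc n) ⟩
  (3 + n) * c (1 + n) * 2   ≡⟨ ℕ.*-assoc (3 + n) (c (1 + n)) 2 ⟩
  (3 + n) * (c (1 + n) * 2) ≡⟨ cong ((3 + n) *_) (c-suc*2≡! n) ⟩
  (3 + n) * (2 + n) !       ∎
  where open ≡-Reasoning

/-cross : (a b : ℤ) (m n : ℕ) .{{_ : ℕ.NonZero m}} .{{_ : ℕ.NonZero n}} →
          a ℤ.* + n ≡ b ℤ.* + m → a / m ≡ b / n
/-cross a b (suc m) (suc n) eq = ℚ.fromℚᵘ-cong {mkℚᵘ a m} {mkℚᵘ b n} (*≡* eq)

+suc/2 : ∀ k → + suc k / 2 ≡ + k / 2 +ℚ ½
+suc/2 k = ℚ.toℚᵘ-injective (begin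
  ℚ.toℚᵘ (+ suc k / 2)              ≈⟨ ℚ.toℚᵘ-fromℚᵘ (mkℚᵘ (+ suc k) 1) ⟩
  mkℚᵘ (+ suc k) 1                  ≈⟨ *≡* (cross (+ k)) ⟩
  mkℚᵘ (+ k) 1 ℚᵘ.+ mkℚᵘ (+ 1) 1    ≈⟨ ℚᵘ.+-cong (ℚ.toℚᵘ-fromℚᵘ (mkℚᵘ (+ k) 1)) (ℚ.toℚᵘ-fromℚᵘ (mkℚᵘ (+ 1) 1)) ⟨
  ℚ.toℚᵘ (+ k / 2) ℚᵘ.+ ℚ.toℚᵘ ½    ≈⟨ ℚ.toℚᵘ-homo-+ (+ k / 2) ½ ⟨
  ℚ.toℚᵘ (+ k / 2 +ℚ ½)             ∎)
  where
  open import Relation.Binary.Reasoning.Setoid ℚᵘ.≃-setoid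
  cross : ∀ (x : ℤ) → (+ 1 ℤ.+ x) ℤ.* (+ 2 ℤ.* + 2) ≡ (x ℤ.* + 2 ℤ.+ + 1 ℤ.* + 2) ℤ.* + 2
  cross = solve-∀

egf-c-suc : ∀ n → egf c (suc n) ≡ + (2 + n) / 2
egf-c-suc n = /-cross (+ c (suc n)) (+ (2 + n)) ((suc n) !) 2 (begin
  + c (suc n) ℤ.* + 2       ≡⟨ ℤ.pos-* (c (suc n)) 2 ⟨
  + (c (suc n) * 2)         ≡⟨ cong +_ (c-suc*2≡! n) ⟩
  + ((2 + n) * (suc n) !)   ≡⟨ ℤ.pos-* (2 + n) ((suc n) !) ⟩
  + (2 + n) ℤ.* + ((suc n) !) ∎)
  where
  open ≡-Reasoning
  instance _ = suc n ℕ.!≢0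

egf-c-step : ∀ n → egf c (2 + n) ≡ egf c (1 + n) +ℚ ½
egf-c-step n = trans (egf-c-suc (suc n)) (trans (+suc/2 (2 + n)) (cong (_+ℚ ½) (sym (egf-c-suc n))))

⊛-suc : (f g : FPS) (n : ℕ) → (f ⊛ g) (suc n) ≡ f 0 *ℚ g (suc n) +ℚ ((f ∘′ suc) ⊛ g) n
⊛-suc f g n = cong (λ terms → f 0 *ℚ g (suc n) +ℚ List.foldr _+ℚ_ 0ℚ terms) (begin
  List.map term (List.applyUpTo suc (suc n))  ≡⟨ List.map-applyUpTo suc term (suc n) ⟩
  List.applyUpTo (term ∘′ suc) (suc n)        ≡⟨ List.map-upTo (term ∘′ suc) (suc n) ⟨
  List.map (term ∘′ suc) (upTo (suc n))       ∎)
  where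
  open ≡-Reasoning
  term = λ k → f k *ℚ g (suc n ℕ.∸ k)

⊛-quadratic : (f : FPS) (a b d : ℚ) (m : ℕ) →
              (f ⊛ poly (a ∷ b ∷ d ∷ [])) (2 + m) ≡ f m *ℚ d +ℚ (f (1 + m) *ℚ b +ℚ (f (2 + m) *ℚ a +ℚ 0ℚ))
⊛-quadratic f a b d zero    = refl
⊛-quadratic f a b d (suc m) = begin
  (f ⊛ p) (3 + m)                           ≡⟨ ⊛-suc f p (2 + m) ⟩
  f 0 *ℚ 0ℚ +ℚ ((f ∘′ suc) ⊛ p) (2 + m)    ≡⟨ cong (_+ℚ ((f ∘′ suc) ⊛ p) (2 + m)) (ℚ.*-zeroʳ (f 0)) ⟩
  0ℚ +ℚ ((f ∘′ suc) ⊛ p) (2 + m)           ≡⟨ ℚ.+-identityˡ _ ⟩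
  ((f ∘′ suc) ⊛ p) (2 + m)                 ≡⟨ ⊛-quadratic (f ∘′ suc) a b d m ⟩
  f (1 + m) *ℚ d +ℚ (f (2 + m) *ℚ b +ℚ (f (3 + m) *ℚ a +ℚ 0ℚ)) ∎
  where
  open ≡-Reasoning
  p = poly (a ∷ b ∷ d ∷ [])

second-difference-vanishes : ∀ x →
  x *ℚ ι (+ 2) +ℚ ((x +ℚ ½) *ℚ ι (- (+ 4)) +ℚ (((x +ℚ ½) +ℚ ½) *ℚ ι (+ 2) +ℚ 0ℚ)) ≡ 0ℚ
second-difference-vanishes = solve 1
  (λ x → x :* con (ι (+ 2)) :+ ((x :+ con ½) :* con (ι (- (+ 4))) :+ (((x :+ con ½) :+ con ½) :* con (ι (+ 2)) :+ con 0ℚ))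
         := con 0ℚ)
  refl
  where open +-*-Solver using (solve; _:+_; _:*_; con; _:=_)

corollary6p3 : ∀ (n : ℕ) →
    (egf c ⊛ poly (ι (+ 2) ∷ ι (- (+ 4)) ∷ ι (+ 2) ∷ [])) n
    ≡ poly (ι (+ 2) ∷ ι (- (+ 2)) ∷ ι (+ 1) ∷ []) n
corollary6p3 0 = refl
corollary6p3 1 = refl
corollary6p3 2 = refl
corollary6p3 (suc (suc (suc n))) = begin
  (egf c ⊛ poly (ι (+ 2) ∷ ι (- (+ 4)) ∷ ι (+ 2) ∷ [])) (3 + n)
    ≡⟨ ⊛-quadratic (egf c) _ _ _ (suc n) ⟩
  e₁ *ℚ ι (+ 2) +ℚ (egf c (2 + n) *ℚ ι (- (+ 4)) +ℚ (egf c (3 + n) *ℚ ι (+ 2) +ℚ 0ℚ))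
    ≡⟨ cong₂ (λ e₂ e₃ → e₁ *ℚ ι (+ 2) +ℚ (e₂ *ℚ ι (- (+ 4)) +ℚ (e₃ *ℚ ι (+ 2) +ℚ 0ℚ)))
             (egf-c-step n) (trans (egf-c-step (suc n)) (cong (_+ℚ ½) (egf-c-step n))) ⟩
  e₁ *ℚ ι (+ 2) +ℚ ((e₁ +ℚ ½) *ℚ ι (- (+ 4)) +ℚ (((e₁ +ℚ ½) +ℚ ½) *ℚ ι (+ 2) +ℚ 0ℚ))
    ≡⟨ second-difference-vanishes e₁ ⟩
  0ℚ ∎
  where
  open ≡-Reasoning
  e₁ = egf c (suc n)
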